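{- Let $M$ be a finite Ramsey monoid. Then, for any $n\geq 1$, for all sequences of pointed $M$-sets $(X_k)_{k\in\omega}$ on which $M$ acts uniformly, and for any finite coloring of the $n$-subsets of $\langle (X_k)_{k\in\omega}\rangle$, there is a basic sequence $\bar s\in\langle (X_k)_{k\in\omega}\rangle^{\omega}$ such that $s_k$ has a distinguished point for every $k\in\omega$ and such that $\bigcup_{\bar r\leq_M\bar s}\bar r^{(n)}$ is monochromatic.
   Context: An $M$-set is a set on which the monoid $M$ acts; a pointed $M$-set is an $M$-set $X$ with a distinguished point $x$ such that $Mx=X$. The action of $M$ on a family $(X_k)_{k\in\omega}$ of $M$-sets is uniform if it extends to an action on $\bigcup_k X_k$. $\langle (X_k)_{k\in\omega}\rangle$ is the partial semigroup (under concatenation ${}^\frown$) of finite sequences $x_1{}^\frown\cdots{}^\frown x_m$ for which there are $i_1<\dots<i_m$ with $x_j\in X_{i_j}$, with coordinate-wise action of $M$. A sequence $\bar s$ in it is basic if $s_{i_0}{}^\frown\cdots{}^\frown s_{i_m}$ is defined for all $i_0<\dots<i_m$. The $M$-span $\langle\bar t\rangle_M$ of a sequence is the set of products $m_0t_{i_0}\cdots m_kt_{i_k}$ with $i_0<\dots<i_k$, $m_i\in M$, at least one $m_i=1_M$. $M$ is Ramsey if for every sequence of pointed $M$-sets $(X_k)$ on which $M$ acts uniformly and every finite coloring of $\langle (X_k)_{k\in\omega}\rangle$ there is a basic sequence $\bar s$, each $s_k$ containing a distinguished point, with $\langle\bar s\rangle_M$ monochromatic. For sequences $\bar r,\bar s$,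 $\bar r\leq_M\bar s$ means there is an increasing sequence $(i_k)_{k\in\omega}$ with $r_k\in\langle s_{i_k},\dots,s_{i_{k+1}-1}\rangle_M$. For a sequence $\bar s$ in a semigroup $S$, $\bar s^{(n)}$ is the collection of $n$-subsets of $\{a\in S: a=s_i \text{ for some } i\in\omega\}$. -}

module Defs where

open import Level using (0ℓ)
open import Algebra.Bundles using (Monoid)
open import Data.Nat using (ℕ; suc; _≤_; _<_)
open import Data.Fin using (Fin)
open import Data.List using (List; []; _∷_; [_]; _++_; concat; map; zipWith; length; foldr)
open import Data.List.Relation.Unary.Any using (Any)
open import Data.List.Relation.Unary.All using (All)
open import Data.List.Relation.Unary.Linked using (Linked)
open import Data.List.Membership.Propositional using (_∈_)
open import Data.Product using (Σ; ∃; _×_; _,_)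
open import Relation.Binary.PropositionalEquality using (_≡_; _≢_)

IsFiniteMonoid : Monoid 0ℓ 0ℓ → Set
IsFiniteMonoid M = ∃ λ (k : ℕ) → Σ (Fin k → Carrier) λ f → ∀ m → ∃ λ j → f j ≈ m
  where open Monoid M

module _ (M : Monoid 0ℓ 0ℓ) where
  open Monoid M renaming (Carrier to Mon)

  -- A sequence (X_k)_{k∈ω} of pointed M-sets on which M acts uniformly:
  -- the action is one action `act` of M on a type U (containing ⋃_k X_k),
  -- each X_k ⊆ U is closed under it, and X_k = M·pt k.
  record UniformPointedFamily : Set₁ where
    field
      U       : Set
      act     : Mon → U → U
      act-ε   : ∀ x → act ε x ≡ x
      act-∙   : ∀ m m′ x → act (m ∙ m′) x ≡ act m (act m′ x)
      act-≈   : ∀ {m m′} x → m ≈ m′ → act m x ≡ act m′ x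
      X       : ℕ → U → Set
      X-closed : ∀ k m x → X k x → X k (act m x)
      pt      : ℕ → U
      pt∈X    : ∀ k → X k (pt k)
      pt-gen  : ∀ k y → X k y → ∃ λ m → act m (pt k) ≡ y

  module Family (F : UniformPointedFamily) where
    open UniformPointedFamily F public

    -- `Valid b xs`: xs = x_1 ⁀ ⋯ ⁀ x_m (m ≥ 1) with x_j ∈ X_{i_j},
    -- b ≤ i_1 < ⋯ < i_m.
    data Valid (b : ℕ) : List U → Set where
      one  : ∀ {i x} → b ≤ i → X i x → Valid b [ x ]
      cons : ∀ {i x xs} → b ≤ i → X i x → Valid (suc i) xs → Valid b (x ∷ xs)

    InGen : List U → Set
    InGen = Valid 0

    actS : Mon → List U → List U
    actS m = map (act m)

    IncIdx : List ℕ → Set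
    IncIdx is = (is ≢ []) × Linked _<_ is

    Basic : (ℕ → List U) → Set
    Basic s = ∀ is → IncIdx is → InGen (concat (map s is))

    HasPt : List U → Set
    HasPt xs = ∃ λ i → pt i ∈ xs

    SpanBetween : (ℕ → List U) → ℕ → ℕ → List U → Set
    SpanBetween t a b y =
      ∃ λ (is : List ℕ) → ∃ λ (ms : List Mon) →
        IncIdx is × All (λ i → a ≤ i × i < b) is × length ms ≡ length is ×
        Any (λ m → m ≈ ε) ms ×
        y ≡ concat (zipWith (λ m i → actS m (t i)) ms is)

    Span : (ℕ → List U) → List U → Set
    Span t y =
      ∃ λ (is : List ℕ) → ∃ λ (ms : List Mon) →
        IncIdx is × length ms ≡ length is ×
        Any (λ m → m ≈ ε) ms ×
        y ≡ concat (zipWith (λ m i → actS m (t i)) ms is)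

    _≤M_ : (ℕ → List U) → (ℕ → List U) → Set
    r ≤M s = ∃ λ (i : ℕ → ℕ) → (∀ k → i k < i (suc k)) ×
               (∀ k → SpanBetween s (i k) (i (suc k)) (r k))

  IsRamsey : Set₁
  IsRamsey = ∀ (F : UniformPointedFamily) (r : ℕ)
    (c : List (UniformPointedFamily.U F) → Fin r) →
    let open Family F in
    ∃ λ (s : ℕ → List U) → Basic s × (∀ k → HasPt (s k)) ×
      ∃ λ (κ : Fin r) → ∀ y → Span s y → c y ≡ κ

-- Ordered version first, by induction on n: every pointed basic sequence B has a pointed basic
-- S ≼ B such that c (t j₀ , … , t j_{n-1}) has one colour for all t ≼ S and j₀ < ⋯ < j_{n-1}.
-- For the step, a fusion argument produces d ≼ B with reservoirs B k such that for every x in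
-- the span of d 0, …, d k the colouring c (x , _) is already homogeneous on B (k + 1); finiteness
-- of M makes these x finitely many up to normalisation of the letters. Colour a word x over d by
-- c (x , d K , … , d (K + n - 1)) with K beyond every index used by x, and apply the Ramsey
-- property of M to the orbits M d k, tagged by k: this yields s ≼ d on which that colour is
-- constant. For t ≼ s the entries t j₁ , … are spanned by d K , d (K + 1) , …, so the colour of
-- (t j₀ , t j₁ , …) is the colour of t j₀. Symmetry of c and sorting give the unordered form.

module Submission where

open import Level using (0ℓ)
open import Algebra.Bundles using (Monoid)
open import Function using (_∘_; id)
open import Data.Product using (Σ; ∃; _×_; _,_; proj₁; proj₂)
open import Data.Sum using (inj₁; inj₂)
open import Data.Nat using (ℕ; zero; suc; _≤_; _<_; z≤n; s≤s; _+_; _∸_; _≟_; _≤′_; ≤′-refl; ≤′-step)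
open import Data.Nat.Properties
  using ( ≤-refl; ≤-trans; <⇒≤; ≤-<-trans; <-≤-trans; <⇒≢; ≤∧≢⇒<; ≤⇒≯; ≤⇒≤′; m≤n⇒m<n∨m≡n; n≤1+n; m≤m+n
        ; suc-injective; +-suc; +-identityʳ; +-monoʳ-≤; +-monoʳ-<; +-∸-assoc; m+[n∸m]≡n; n∸n≡0
        ; ∸-monoˡ-≤; ∸-monoˡ-<; ≤-decTotalOrder )
open import Data.Fin using (Fin)
open import Data.Vec using (Vec; toList) renaming ([] to []ᵥ; _∷_ to _∷ᵥ_)
open import Data.Vec.Properties using (length-toList)
open import Data.List using (List; []; _∷_; [_]; _++_; concat; concatMap; map; zipWith; length; allFin; upTo; applyUpTo)
open import Data.List.Properties
  using (map-++; map-cong; map-id; map-∘; map-applyUpTo; ++-identityʳ; ++-assoc; length-map; ∷-injective)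
open import Data.List.Extrema.Nat using (max; xs≤max; max<v⁺)
open import Data.List.Membership.Propositional using (_∈_)
open import Data.List.Membership.Propositional.Properties using (∈-map⁺; ∈-concat⁺′; ∈-allFin; ∈-++⁺ˡ; ∈-++⁺ʳ)
open import Data.List.Relation.Unary.Any using (Any; here; there)
open import Data.List.Relation.Unary.Any.Properties using (++⁺ˡ; ++⁺ʳ) renaming (map⁺ to Any-map⁺; map⁻ to Any-map⁻)
open import Data.List.Relation.Unary.All using (All; []; _∷_)
import Data.List.Relation.Unary.All as All
import Data.List.Relation.Unary.All.Properties as All
open import Data.List.Relation.Unary.AllPairs using (_∷_)
open import Data.List.Relation.Unary.Linked using (Linked; []; [-]; _∷_)
open import Data.List.Relation.Unary.Linked.Properties using () renaming (applyUpTo⁺₂ to Linked-applyUpTo⁺₂)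
open import Data.List.Relation.Unary.Unique.Propositional using (Unique)
import Data.List.Relation.Unary.Unique.Propositional.Properties as Unique
open import Data.List.Relation.Binary.Pointwise using (Pointwise; []; _∷_)
open import Data.List.Relation.Binary.Permutation.Propositional using (_↭_; ↭-sym; ↭-trans; ↭-reflexive; ↭⇒↭ₛ)
open import Data.List.Relation.Binary.Permutation.Propositional.Properties using (↭-length) renaming (map⁺ to ↭-map⁺)
open import Data.List.Sort ≤-decTotalOrder using (sort; sort-↭; sort-↗)
open import Relation.Nullary using (yes; no; contradiction)
open import Relation.Binary.PropositionalEquality
  using (setoid; _≡_; _≢_; refl; sym; trans; cong; cong₂; subst; module ≡-Reasoning)
open import Data.List.Relation.Binary.Permutation.Setoid.Properties (setoid ℕ) using (Unique-resp-↭)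

open import Defs

data Ascending (b : ℕ) : List ℕ → Set where
  []  : Ascending b []
  _∷_ : ∀ {i is} → b ≤ i → Ascending (suc i) is → Ascending b (i ∷ is)

Ascending-weaken : ∀ {a b is} → a ≤ b → Ascending b is → Ascending a is
Ascending-weaken a≤b []          = []
Ascending-weaken a≤b (b≤i ∷ asc) = ≤-trans a≤b b≤i ∷ asc

Ascending⇒All≥ : ∀ {b is} → Ascending b is → All (b ≤_) is
Ascending⇒All≥ []          = []
Ascending⇒All≥ (b≤i ∷ asc) = b≤i ∷ All.map (≤-trans (≤-trans b≤i (n≤1+n _))) (Ascending⇒All≥ asc)

Ascending-++ : ∀ {b c xs ys} → b ≤ c → Ascending b xs → All (_< c) xs → Ascending c ys → Ascending b (xs ++ ys)
Ascending-++ b≤c []          []           asc = Ascending-weaken b≤c asc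
Ascending-++ b≤c (b≤i ∷ xs↑) (i<c ∷ xs<c) asc = b≤i ∷ Ascending-++ i<c xs↑ xs<c asc

Ascending-++⇒separated : ∀ {b} xs {ys} → Ascending b (xs ++ ys) → All (λ y → All (_< y) xs) ys
Ascending-++⇒separated []       asc       = All.universal (λ _ → []) _
Ascending-++⇒separated (x ∷ xs) (_ ∷ asc) =
  All.zipWith (λ (x<y , xs<y) → x<y ∷ xs<y) (All.++⁻ʳ xs (Ascending⇒All≥ asc) , Ascending-++⇒separated xs asc)

Ascending-map-+ : ∀ p {b is} → Ascending b is → Ascending (p + b) (map (p +_) is)
Ascending-map-+ p []                      = []
Ascending-map-+ p (_∷_ {i} {is} b≤i asc) =
  +-monoʳ-≤ p b≤i ∷ subst (λ c → Ascending c (map (p +_) is)) (+-suc p i) (Ascending-map-+ p asc)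

Ascending-map-∸ : ∀ p {b is} → p ≤ b → Ascending b is → Ascending (b ∸ p) (map (_∸ p) is)
Ascending-map-∸ p p≤b []                      = []
Ascending-map-∸ p p≤b (_∷_ {i} {is} b≤i asc) =
  ∸-monoˡ-≤ p b≤i ∷
  subst (λ c → Ascending c (map (_∸ p) is)) (+-∸-assoc 1 p≤i) (Ascending-map-∸ p (≤-trans p≤i (n≤1+n i)) asc)
  where
  p≤i : p ≤ i
  p≤i = ≤-trans p≤b b≤i

Ascending⇒Linked : ∀ {b is} → Ascending b is → Linked _<_ is
Ascending⇒Linked []                = []
Ascending⇒Linked (_ ∷ [])          = [-]
Ascending⇒Linked (_ ∷ (i<j ∷ asc)) = i<j ∷ Ascending⇒Linked (i<j ∷ asc)

Linked⇒Ascending : ∀ {b is} → All (b ≤_) is → Linked _<_ is → Ascending b is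
Linked⇒Ascending []        []  = []
Linked⇒Ascending (b≤i ∷ _) lnk = from-head b≤i lnk
  where
  from-head : ∀ {b i is} → b ≤ i → Linked _<_ (i ∷ is) → Ascending b (i ∷ is)
  from-head b≤i [-]         = b≤i ∷ []
  from-head b≤i (i<j ∷ lnk) = b≤i ∷ from-head i<j lnk

Ascending-upTo : ∀ n → Ascending 0 (upTo n)
Ascending-upTo n = Linked⇒Ascending (All.universal (λ _ → z≤n) _) (Linked-applyUpTo⁺₂ id n (λ _ → ≤-refl))

Linked≤-unique⇒Linked< : ∀ {is} → Linked _≤_ is → Unique is → Linked _<_ is
Linked≤-unique⇒Linked< []          _                    = []
Linked≤-unique⇒Linked< [-]         _                    = [-]
Linked≤-unique⇒Linked< (i≤j ∷ lnk) ((i≢j ∷ _) ∷ unique) = ≤∧≢⇒< i≤j i≢j ∷ Linked≤-unique⇒Linked< lnk unique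

sort-ascending : ∀ {is} → Unique is → Ascending 0 (sort is)
sort-ascending {is} unique =
  Linked⇒Ascending (All.universal (λ _ → z≤n) _)
    (Linked≤-unique⇒Linked< (sort-↗ is) (Unique-resp-↭ (↭⇒↭ₛ (↭-sym (sort-↭ is))) unique))

module StrictlyMonotone (σ : ℕ → ℕ) (σ-< : ∀ k → σ k < σ (suc k)) where

  σ-mono-≤′ : ∀ {a b} → a ≤′ b → σ a ≤ σ b
  σ-mono-≤′ ≤′-refl        = ≤-refl
  σ-mono-≤′ (≤′-step a≤′b) = ≤-trans (σ-mono-≤′ a≤′b) (<⇒≤ (σ-< _))

  σ-mono-≤ : ∀ {a b} → a ≤ b → σ a ≤ σ b
  σ-mono-≤ a≤b = σ-mono-≤′ (≤⇒≤′ a≤b)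

  σ-mono-< : ∀ {a b} → a < b → σ a < σ b
  σ-mono-< {a} a<b = <-≤-trans (σ-< a) (σ-mono-≤ a<b)

map-cong-All : ∀ {A B : Set} {f g : A → B} {xs} → All (λ x → f x ≡ g x) xs → map f xs ≡ map g xs
map-cong-All []            = refl
map-cong-All (fx≡gx ∷ eqs) = cong₂ _∷_ fx≡gx (map-cong-All eqs)

indicesOf : ∀ {A : Set} (t : ℕ → A) {l} → All (λ y → ∃ λ i → y ≡ t i) l → ∃ λ is → l ≡ map t is
indicesOf t []                  = [] , refl
indicesOf t ((i , y≡tᵢ) ∷ ∃is) = let (is , l≡) = indicesOf t ∃is in i ∷ is , cong₂ _∷_ y≡tᵢ l≡

vecOf : ∀ {A : Set} {n} (l : List A) → length l ≡ n → Σ (Vec A n) λ w → toList w ≡ l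
vecOf []      refl = []ᵥ , refl
vecOf (x ∷ l) refl = let (w , w≡) = vecOf l refl in x ∷ᵥ w , cong (x ∷_) w≡

sortAlong : ∀ {A : Set} {n} (t : ℕ → A) (v : Vec A n) is → toList v ≡ map t is →
            Σ (Vec A n) λ w → toList v ↭ toList w × toList w ≡ map t (sort is)
sortAlong {n = n} t v is v≡ =
  let (w , w≡) = vecOf (map t (sort is)) length≡
  in w , ↭-trans (↭-sym sorted↭v) (↭-reflexive (sym w≡)) , w≡
  where
  sorted↭v : map t (sort is) ↭ toList v
  sorted↭v = ↭-trans (↭-map⁺ t (sort-↭ is)) (↭-reflexive (sym v≡))
  length≡ : length (map t (sort is)) ≡ n
  length≡ = trans (↭-length sorted↭v) (length-toList v)

prefixVec : ∀ {A : Set} → (ℕ → A) → (n : ℕ) → Vec A n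
prefixVec f zero    = []ᵥ
prefixVec f (suc n) = f 0 ∷ᵥ prefixVec (f ∘ suc) n

toList-prefixVec : ∀ {A : Set} (f : ℕ → A) n → toList (prefixVec f n) ≡ map f (upTo n)
toList-prefixVec f n = trans (toList≡applyUpTo f n) (sym (map-applyUpTo id f n))
  where
  toList≡applyUpTo : ∀ {A : Set} (f : ℕ → A) n → toList (prefixVec f n) ≡ applyUpTo f n
  toList≡applyUpTo f zero    = refl
  toList≡applyUpTo f (suc n) = cong (f 0 ∷_) (toList≡applyUpTo (f ∘ suc) n)

update : ∀ {A : Set} → (ℕ → A) → ℕ → A → ℕ → A
update f k v j with j ≟ k
... | yes _ = v
... | no  _ = f j

update-≡ : ∀ {A : Set} (f : ℕ → A) k v → update f k v k ≡ v
update-≡ f k v with k ≟ k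
... | yes _   = refl
... | no  k≢k = contradiction refl k≢k

update-≢ : ∀ {A : Set} (f : ℕ → A) {k} v {j} → j ≢ k → update f k v j ≡ f j
update-≢ f {k} v {j} j≢k with j ≟ k
... | yes j≡k = contradiction j≡k j≢k
... | no  _   = refl

module Words (M : Monoid 0ℓ 0ℓ) (F : UniformPointedFamily M) where
  open Monoid M using (_≈_; _∙_; ε; ∙-cong; identityˡ) renaming (Carrier to Mon; refl to ≈-refl; trans to ≈-trans)
  open Family M F

  actS-++ : ∀ m xs ys → actS m (xs ++ ys) ≡ actS m xs ++ actS m ys
  actS-++ m = map-++ (act m)

  actS-ε : ∀ xs → actS ε xs ≡ xs
  actS-ε xs = trans (map-cong act-ε xs) (map-id xs)

  actS-≈ : ∀ {m m′} → m ≈ m′ → ∀ xs → actS m xs ≡ actS m′ xs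
  actS-≈ m≈m′ = map-cong (λ x → act-≈ x m≈m′)

  actS-∙ : ∀ m m′ xs → actS (m ∙ m′) xs ≡ actS m (actS m′ xs)
  actS-∙ m m′ xs = trans (map-cong (act-∙ m m′) xs) (map-∘ xs)

  -- The word (m₀ , i₀) ⋯ (m_k , i_k) denotes the product m₀ s_{i₀} ⋯ m_k s_{i_k}.
  Word : Set
  Word = List (Mon × ℕ)

  indices : Word → List ℕ
  indices = map proj₂

  eval : (ℕ → List U) → Word → List U
  eval s []             = []
  eval s ((m , i) ∷ ws) = actS m (s i) ++ eval s ws

  HasUnit : Word → Set
  HasUnit = Any (λ p → proj₁ p ≈ ε)

  record Spans (s : ℕ → List U) (a b : ℕ) (y : List U) : Set where
    constructor spans
    field
      word      : Word
      ascending : Ascending a (indices word)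
      bounded   : All (_< b) (indices word)
      unit      : HasUnit word
      value     : y ≡ eval s word

  record _≼_ (t s : ℕ → List U) : Set where
    constructor below
    field
      cut   : ℕ → ℕ
      cut-< : ∀ k → cut k < cut (suc k)
      block : ∀ k → Spans s (cut k) (cut (suc k)) (t k)

  Basic′ : (ℕ → List U) → Set
  Basic′ s = ∀ {i is} → Ascending 0 (i ∷ is) → InGen (concat (map s (i ∷ is)))

  record PointedBasic : Set where
    constructor pointedBasic
    field
      seq     : ℕ → List U
      basic   : Basic′ seq
      pointed : ∀ k → HasPt (seq k)

  eval-++ : ∀ s ws vs → eval s (ws ++ vs) ≡ eval s ws ++ eval s vs
  eval-++ s []             vs = refl
  eval-++ s ((m , i) ∷ ws) vs =
    trans (cong (actS m (s i) ++_) (eval-++ s ws vs)) (sym (++-assoc (actS m (s i)) (eval s ws) (eval s vs)))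

  scale : Mon → Word → Word
  scale m = map (λ p → m ∙ proj₁ p , proj₂ p)

  actS-eval : ∀ s m ws → actS m (eval s ws) ≡ eval s (scale m ws)
  actS-eval s m []              = refl
  actS-eval s m ((m′ , i) ∷ ws) =
    trans (actS-++ m (actS m′ (s i)) (eval s ws)) (cong₂ _++_ (sym (actS-∙ m m′ (s i))) (actS-eval s m ws))

  indices-scale : ∀ m ws → indices (scale m ws) ≡ indices ws
  indices-scale m ws = sym (map-∘ ws)

  HasUnit-scale : ∀ {m} → m ≈ ε → ∀ {ws} → HasUnit ws → HasUnit (scale m ws)
  HasUnit-scale m≈ε (here m′≈ε) = here (≈-trans (∙-cong m≈ε m′≈ε) (identityˡ ε))
  HasUnit-scale m≈ε (there u)   = there (HasUnit-scale m≈ε u)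

  Orbitwise : List U → List U → Set
  Orbitwise = Pointwise (λ x y → ∃ λ m → y ≡ act m x)

  Valid-orbitwise : ∀ {b xs ys} → Valid b xs → Orbitwise xs ys → Valid b ys
  Valid-orbitwise (one b≤i x∈X)      ((m , refl) ∷ []) = one b≤i (X-closed _ m _ x∈X)
  Valid-orbitwise (cons b≤i x∈X val) ((m , refl) ∷ o)  = cons b≤i (X-closed _ m _ x∈X) (Valid-orbitwise val o)

  Orbitwise-++ : ∀ {xs ys xs′ ys′} → Orbitwise xs ys → Orbitwise xs′ ys′ → Orbitwise (xs ++ xs′) (ys ++ ys′)
  Orbitwise-++ []      o′ = o′
  Orbitwise-++ (p ∷ o) o′ = p ∷ Orbitwise-++ o o′

  Orbitwise-actS : ∀ m xs → Orbitwise xs (actS m xs)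
  Orbitwise-actS m []       = []
  Orbitwise-actS m (x ∷ xs) = (m , refl) ∷ Orbitwise-actS m xs

  Orbitwise-eval : ∀ s ws → Orbitwise (concat (map s (indices ws))) (eval s ws)
  Orbitwise-eval s []             = []
  Orbitwise-eval s ((m , i) ∷ ws) = Orbitwise-++ (Orbitwise-actS m (s i)) (Orbitwise-eval s ws)

  eval-InGen : ∀ {s} → Basic′ s → ∀ {ws} → Ascending 0 (indices ws) → HasUnit ws → InGen (eval s ws)
  eval-InGen {s} basic {w ∷ ws} asc _ = Valid-orbitwise (basic asc) (Orbitwise-eval s (w ∷ ws))

  eval-cong : ∀ {s s′} ws → All (λ i → s i ≡ s′ i) (indices ws) → eval s ws ≡ eval s′ ws
  eval-cong []             []           = refl
  eval-cong ((m , i) ∷ ws) (sᵢ≡ ∷ s≡) = cong₂ _++_ (cong (actS m) sᵢ≡) (eval-cong ws s≡)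

  module _ {s u : ℕ → List U} (s≼u : s ≼ u) where
    open _≼_ s≼u
    open StrictlyMonotone cut cut-<

    expand : Mon × ℕ → Word
    expand (m , j) = scale m (Spans.word (block j))

    indices-expand : ∀ p → indices (expand p) ≡ indices (Spans.word (block (proj₂ p)))
    indices-expand (m , j) = indices-scale m (Spans.word (block j))

    expand-ascending : ∀ p → Ascending (cut (proj₂ p)) (indices (expand p))
    expand-ascending p = subst (Ascending _) (sym (indices-expand p)) (Spans.ascending (block (proj₂ p)))

    expand-bounded : ∀ p → All (_< cut (suc (proj₂ p))) (indices (expand p))
    expand-bounded p = subst (All _) (sym (indices-expand p)) (Spans.bounded (block (proj₂ p)))

    concatMap-expand-ascending : ∀ {a} ws → Ascending a (indices ws) → Ascending (cut a) (indices (concatMap expand ws))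
    concatMap-expand-ascending []       []          = []
    concatMap-expand-ascending (p ∷ ws) (a≤i ∷ asc) rewrite map-++ proj₂ (expand p) (concatMap expand ws) =
      Ascending-++ (σ-mono-≤ (≤-trans a≤i (n≤1+n _))) (Ascending-weaken (σ-mono-≤ a≤i) (expand-ascending p))
        (expand-bounded p) (concatMap-expand-ascending ws asc)

    concatMap-expand-bounded : ∀ {b} ws → All (_< b) (indices ws) → All (_< cut b) (indices (concatMap expand ws))
    concatMap-expand-bounded []       []           = []
    concatMap-expand-bounded (p ∷ ws) (i<b ∷ ws<b) rewrite map-++ proj₂ (expand p) (concatMap expand ws) =
      All.++⁺ (All.map (λ k<cut → <-≤-trans k<cut (σ-mono-≤ i<b)) (expand-bounded p)) (concatMap-expand-bounded ws ws<b)

    concatMap-expand-unit : ∀ {ws} → HasUnit ws → HasUnit (concatMap expand ws)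
    concatMap-expand-unit {(m , j) ∷ _} (here m≈ε) = ++⁺ˡ (HasUnit-scale m≈ε (Spans.unit (block j)))
    concatMap-expand-unit {p ∷ _}       (there u)  = ++⁺ʳ (expand p) (concatMap-expand-unit u)

    eval-expand : ∀ p → eval u (expand p) ≡ actS (proj₁ p) (s (proj₂ p))
    eval-expand (m , j) = trans (sym (actS-eval u m (Spans.word (block j)))) (cong (actS m) (sym (Spans.value (block j))))

    eval-concatMap-expand : ∀ ws → eval u (concatMap expand ws) ≡ eval s ws
    eval-concatMap-expand []       = refl
    eval-concatMap-expand (p ∷ ws) =
      trans (eval-++ u (expand p) (concatMap expand ws)) (cong₂ _++_ (eval-expand p) (eval-concatMap-expand ws))

    Spans-≼ : ∀ {a b y} → Spans s a b y → Spans u (cut a) (cut b) y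
    Spans-≼ (spans ws asc bnd unit y≡) =
      spans (concatMap expand ws) (concatMap-expand-ascending ws asc) (concatMap-expand-bounded ws bnd)
        (concatMap-expand-unit unit) (trans y≡ (sym (eval-concatMap-expand ws)))

  ≼-trans : ∀ {r s u} → r ≼ s → s ≼ u → r ≼ u
  ≼-trans (below ρ ρ-< r-blocks) s≼u@(below σ σ-< _) =
    below (λ k → σ (ρ k)) (λ k → σ-mono-< (ρ-< k)) (λ k → Spans-≼ s≼u (r-blocks k))
    where open StrictlyMonotone σ σ-<

  Spans-widen : ∀ {s a b b′ y} → b ≤ b′ → Spans s a b y → Spans s a b′ y
  Spans-widen b≤b′ (spans ws asc bnd unit y≡) = spans ws asc (All.map (λ i<b → <-≤-trans i<b b≤b′) bnd) unit y≡

  Spans-single : ∀ s i → Spans s i (suc i) (s i)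
  Spans-single s i =
    spans [ (ε , i) ] (≤-refl ∷ []) (≤-refl ∷ []) (here ≈-refl) (sym (trans (++-identityʳ _) (actS-ε (s i))))

  ≼-respˡ : ∀ {t t′ s} → (∀ k → t k ≡ t′ k) → t ≼ s → t′ ≼ s
  ≼-respˡ t≗t′ (below ρ ρ-< blocks) = below ρ ρ-< (λ k → subst (Spans _ _ _) (t≗t′ k) (blocks k))

  ≼-refl : ∀ s → s ≼ s
  ≼-refl s = below (λ k → k) (λ k → ≤-refl) (Spans-single s)

  unitWord : List ℕ → Word
  unitWord = map (ε ,_)

  indices-unitWord : ∀ is → indices (unitWord is) ≡ is
  indices-unitWord is = trans (sym (map-∘ is)) (map-id is)

  eval-unitWord : ∀ s is → eval s (unitWord is) ≡ concat (map s is)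
  eval-unitWord s []       = refl
  eval-unitWord s (i ∷ is) = cong₂ _++_ (actS-ε (s i)) (eval-unitWord s is)

  Basic-≼ : ∀ {t s} → t ≼ s → Basic′ s → Basic′ t
  Basic-≼ {t} t≼s basic {i} {is} asc =
    subst InGen (trans (eval-concatMap-expand t≼s ws) (eval-unitWord t (i ∷ is)))
      (eval-InGen basic (Ascending-weaken z≤n (concatMap-expand-ascending t≼s ws ws↑))
                        (concatMap-expand-unit t≼s {ws} (here ≈-refl)))
    where
    ws = unitWord (i ∷ is)
    ws↑ : Ascending 0 (indices ws)
    ws↑ = subst (Ascending 0) (sym (indices-unitWord (i ∷ is))) asc

  ∈-actS-unit : ∀ {m} → m ≈ ε → ∀ {x xs} → x ∈ xs → x ∈ actS m xs
  ∈-actS-unit m≈ε {xs = xs} x∈xs = subst (_ ∈_) (sym (trans (actS-≈ m≈ε xs) (actS-ε xs))) x∈xs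

  HasPt-eval : ∀ {s} → (∀ k → HasPt (s k)) → ∀ {ws} → HasUnit ws → HasPt (eval s ws)
  HasPt-eval pts {(m , i) ∷ _} (here m≈ε) = let (j , ptⱼ∈) = pts i in j , ++⁺ˡ (∈-actS-unit m≈ε ptⱼ∈)
  HasPt-eval {s} pts {(m , i) ∷ _} (there u) = let (j , ptⱼ∈) = HasPt-eval pts u in j , ++⁺ʳ (actS m (s i)) ptⱼ∈

  HasPt-Spans : ∀ {s} → (∀ k → HasPt (s k)) → ∀ {a b y} → Spans s a b y → HasPt y
  HasPt-Spans pts (spans _ _ _ unit refl) = HasPt-eval pts unit

  reindex : (ℕ → ℕ) → Word → Word
  reindex f = map (λ p → proj₁ p , f (proj₂ p))

  indices-reindex : ∀ f ws → indices (reindex f ws) ≡ map f (indices ws)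
  indices-reindex f ws = trans (sym (map-∘ ws)) (map-∘ ws)

  eval-reindex : ∀ s f ws → eval s (reindex f ws) ≡ eval (s ∘ f) ws
  eval-reindex s f []             = refl
  eval-reindex s f ((m , i) ∷ ws) = cong (actS m (s (f i)) ++_) (eval-reindex s f ws)

  Spans-shift : ∀ {s} p {a b y} → Spans (λ j → s (p + j)) a b y → Spans s (p + a) (p + b) y
  Spans-shift {s} p (spans ws asc bnd unit y≡) =
    spans (reindex (p +_) ws)
      (subst (Ascending _) (sym (indices-reindex (p +_) ws)) (Ascending-map-+ p asc))
      (subst (All _) (sym (indices-reindex (p +_) ws)) (All.map⁺ (All.map (+-monoʳ-< p) bnd)))
      (Any-map⁺ unit) (trans y≡ (sym (eval-reindex s (p +_) ws)))

  Spans-unshift : ∀ {s} p {c e y} → p ≤ c → Spans s c e y → Spans (λ j → s (p + j)) (c ∸ p) (e ∸ p) y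
  Spans-unshift {s} p p≤c (spans ws asc bnd unit y≡) =
    spans (reindex (_∸ p) ws)
      (subst (Ascending _) (sym (indices-reindex (_∸ p) ws)) (Ascending-map-∸ p p≤c asc))
      (subst (All _) (sym (indices-reindex (_∸ p) ws))
        (All.map⁺ (All.zipWith (λ (i<e , p≤i) → ∸-monoˡ-< i<e p≤i) (bnd , p≤ws))))
      (Any-map⁺ unit)
      (trans y≡ (trans (eval-cong ws (All.map (λ p≤i → cong s (sym (m+[n∸m]≡n p≤i))) p≤ws))
                       (sym (eval-reindex (λ j → s (p + j)) (_∸ p) ws))))
    where
    p≤ws : All (p ≤_) (indices ws)
    p≤ws = All.map (≤-trans p≤c) (Ascending⇒All≥ asc)

  Basic′-single : ∀ {s} → Basic′ s → ∀ i → InGen (s i)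
  Basic′-single {s} basic i = subst InGen (++-identityʳ (s i)) (basic (z≤n ∷ []))

  Basic′-pair : ∀ {s} → Basic′ s → ∀ {i j} → i < j → InGen (s i ++ s j)
  Basic′-pair {s} basic {j = j} i<j = subst (λ z → InGen (s _ ++ z)) (++-identityʳ (s j)) (basic (z≤n ∷ i<j ∷ []))

  Basic′-shift : ∀ {s} p → Basic′ s → Basic′ (λ i → s (p + i))
  Basic′-shift {s} p basic {i} {is} asc =
    subst InGen (cong concat (sym (map-∘ (i ∷ is)))) (basic (Ascending-weaken z≤n (Ascending-map-+ p asc)))

  tail : PointedBasic → PointedBasic
  tail (pointedBasic s basic pts) = pointedBasic (λ i → s (suc i)) (Basic′-shift 1 basic) (λ k → pts (suc k))

  Valid-points : ∀ {b i is} → Ascending b (i ∷ is) → Valid b (concat (map (λ k → [ pt k ]) (i ∷ is)))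
  Valid-points {is = []}    (b≤i ∷ [])  = one b≤i (pt∈X _)
  Valid-points {is = _ ∷ _} (b≤i ∷ asc) = cons b≤i (pt∈X _) (Valid-points asc)

  points : PointedBasic
  points = pointedBasic (λ k → [ pt k ]) Valid-points (λ k → k , here refl)

  Basic⇒Basic′ : ∀ {s} → Basic s → Basic′ s
  Basic⇒Basic′ basic asc = basic _ ((λ ()) , Ascending⇒Linked asc)

  Basic′⇒Basic : ∀ {s} → Basic′ s → Basic s
  Basic′⇒Basic basic (i ∷ is) (_ , lnk) = basic (Linked⇒Ascending (All.universal (λ _ → z≤n) _) lnk)
  Basic′⇒Basic basic []       (≢[] , _) with () ← ≢[] refl

  concat-zipWith-letters : ∀ s ws → concat (zipWith (λ m i → actS m (s i)) (map proj₁ ws) (indices ws)) ≡ eval s ws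
  concat-zipWith-letters s []             = refl
  concat-zipWith-letters s ((m , i) ∷ ws) = cong (actS m (s i) ++_) (concat-zipWith-letters s ws)

  Spans⇒Span : ∀ {s a b y} → Spans s a b y → Span s y
  Spans⇒Span {s} (spans ws@(_ ∷ _) asc _ unit y≡) =
    indices ws , map proj₁ ws , ((λ ()) , Ascending⇒Linked asc) ,
    trans (length-map proj₁ ws) (sym (length-map proj₂ ws)) , Any-map⁺ unit ,
    trans y≡ (sym (concat-zipWith-letters s ws))

  wordWith : ∀ (ms : List Mon) is → length ms ≡ length is → Σ Word λ ws → map proj₁ ws ≡ ms × indices ws ≡ is
  wordWith []       []       _   = [] , refl , refl
  wordWith (m ∷ ms) (i ∷ is) len with wordWith ms is (suc-injective len)
  ... | ws , refl , refl = (m , i) ∷ ws , refl , refl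

  SpanBetween⇒Spans : ∀ {s a b y} → SpanBetween s a b y → Spans s a b y
  SpanBetween⇒Spans {s} (is , ms , (_ , lnk) , bnds , len , unit , y≡) with wordWith ms is len
  ... | ws , refl , refl =
    spans ws (Linked⇒Ascending (All.map proj₁ bnds) lnk) (All.map proj₂ bnds) (Any-map⁻ unit)
      (trans y≡ (concat-zipWith-letters s ws))

  ≤M⇒≼ : ∀ {t s} → t ≤M s → t ≼ s
  ≤M⇒≼ (ρ , ρ-< , blocks) = below ρ ρ-< (λ k → SpanBetween⇒Spans (blocks k))

module Tagged (M : Monoid 0ℓ 0ℓ) (F : UniformPointedFamily M) (d : ℕ → List (UniformPointedFamily.U F)) where
  open Monoid M using (_∙_; ε) renaming (refl to ≈-refl)
  open Family M F
  open Words M F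

  -- The family X_k = M d_k, each element tagged with its index k so that it survives flattening.
  tagged : UniformPointedFamily M
  tagged = record
    { U        = ℕ × List U
    ; act      = λ m x → proj₁ x , actS m (proj₂ x)
    ; act-ε    = λ x → cong (proj₁ x ,_) (actS-ε (proj₂ x))
    ; act-∙    = λ m m′ x → cong (proj₁ x ,_) (actS-∙ m m′ (proj₂ x))
    ; act-≈    = λ x m≈m′ → cong (proj₁ x ,_) (actS-≈ m≈m′ (proj₂ x))
    ; X        = λ k x → proj₁ x ≡ k × ∃ λ m → proj₂ x ≡ actS m (d k)
    ; X-closed = λ k m x (tag≡ , m′ , x≡) → tag≡ , m ∙ m′ , trans (cong (actS m) x≡) (sym (actS-∙ m m′ (d k)))
    ; pt       = λ k → k , d k
    ; pt∈X     = λ k → refl , ε , sym (actS-ε (d k))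
    ; pt-gen   = λ k x (tag≡ , m , x≡) → m , cong₂ _,_ (sym tag≡) (sym x≡)
    }

  module T = Family M tagged
  module TW = Words M tagged

  flatten : List T.U → List U
  flatten = concatMap proj₂

  tags : List T.U → List ℕ
  tags = map proj₁

  flatten-++ : ∀ xs ys → flatten (xs ++ ys) ≡ flatten xs ++ flatten ys
  flatten-++ []            ys = refl
  flatten-++ ((_ , l) ∷ xs) ys = trans (cong (l ++_) (flatten-++ xs ys)) (sym (++-assoc l (flatten xs) (flatten ys)))

  flatten-actS : ∀ m xs → flatten (T.actS m xs) ≡ actS m (flatten xs)
  flatten-actS m []            = refl
  flatten-actS m ((_ , l) ∷ xs) = trans (cong (actS m l ++_) (flatten-actS m xs)) (sym (actS-++ m l (flatten xs)))

  flatten-eval : ∀ sT ws → flatten (TW.eval sT ws) ≡ eval (flatten ∘ sT) ws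
  flatten-eval sT []             = refl
  flatten-eval sT ((m , i) ∷ ws) =
    trans (flatten-++ (T.actS m (sT i)) (TW.eval sT ws)) (cong₂ _++_ (flatten-actS m (sT i)) (flatten-eval sT ws))

  -- Evaluate the same words over sT: flattening commutes with evaluation.
  ≼-flatten⁻ : ∀ {t sT} → t ≼ (flatten ∘ sT) → Σ (ℕ → List T.U) λ tT → tT TW.≼ sT × (∀ k → flatten (tT k) ≡ t k)
  ≼-flatten⁻ {t} {sT} (below ρ ρ-< blocks) =
    (λ k → TW.eval sT (Spans.word (blocks k))) ,
    TW.below ρ ρ-< (λ k → let open Spans (blocks k) in TW.spans word ascending bounded unit refl) ,
    (λ k → let open Spans (blocks k) in trans (flatten-eval sT word) (sym value))

  Valid⇒Ascending-tags : ∀ {b l} → T.Valid b l → Ascending b (tags l)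
  Valid⇒Ascending-tags (T.one b≤i (refl , _))      = b≤i ∷ []
  Valid⇒Ascending-tags (T.cons b≤i (refl , _) val) = b≤i ∷ Valid⇒Ascending-tags val

  Spells : List T.U → Word → Set
  Spells l ws = indices ws ≡ tags l × flatten l ≡ eval d ws

  decode : ∀ {b l} → T.Valid b l → Σ Word (Spells l)
  decode (T.one {i} _ (refl , m , refl))      = [ (m , i) ] , refl , refl
  decode (T.cons {i} _ (refl , m , refl) val) =
    let (ws , ix≡ , flat≡) = decode val in (m , i) ∷ ws , cong (i ∷_) ix≡ , cong (actS m (d i) ++_) flat≡

  -- A distinguished point (i , d i) is decoded as the letter (ε , i).
  decode-unit : ∀ {b l} → T.Valid b l → T.HasPt l → Σ Word λ ws → Spells l ws × HasUnit ws
  decode-unit (T.one {i} _ (refl , _)) (_ , here refl) =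
    [ (ε , i) ] , (refl , cong (_++ []) (sym (actS-ε (d i)))) , here ≈-refl
  decode-unit (T.cons {i} _ (refl , _) val) (_ , here refl) =
    let (ws , ix≡ , flat≡) = decode val
    in (ε , i) ∷ ws , (cong (i ∷_) ix≡ , cong₂ _++_ (sym (actS-ε (d i))) flat≡) , here ≈-refl
  decode-unit (T.cons {i} _ (refl , m , refl) val) (j , there pt∈) =
    let (ws , (ix≡ , flat≡) , unit) = decode-unit val (j , pt∈)
    in (m , i) ∷ ws , (cong (i ∷_) ix≡ , cong (actS m (d i) ++_) flat≡) , there unit

  tags-separated : ∀ {b} xs {ys} → T.Valid b (xs ++ ys) → All (λ y → All (_< y) (tags xs)) (tags ys)
  tags-separated xs val =
    Ascending-++⇒separated (tags xs) (subst (Ascending _) (map-++ proj₁ xs _) (Valid⇒Ascending-tags val))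

  firstTag : List T.U → ℕ
  firstTag []      = 0
  firstTag (x ∷ _) = proj₁ x

  All-firstTag : ∀ {P : ℕ → Set} {l} → T.HasPt l → All P (tags l) → P (firstTag l)
  All-firstTag {l = _ ∷ _} _ (p ∷ _) = p

  Ascending-firstTag : ∀ {b l} → Ascending b (tags l) → Ascending (firstTag l) (tags l)
  Ascending-firstTag {l = []}    []        = []
  Ascending-firstTag {l = _ ∷ _} (_ ∷ asc) = ≤-refl ∷ asc

  Spans-flatten : ∀ {b c e l} → T.Valid b l → T.HasPt l → Ascending c (tags l) → All (_< e) (tags l) →
                  Spans d c e (flatten l)
  Spans-flatten val pt asc bnd =
    let (ws , (ix≡ , flat≡) , unit) = decode-unit val pt
    in spans ws (subst (Ascending _) (sym ix≡) asc) (subst (All _) (sym ix≡) bnd) unit flat≡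

  -- Consecutive blocks of a basic tagged sequence occupy consecutive intervals of tags.
  flatten-≼ : ∀ {uT} a → TW.Basic′ uT → (∀ k → T.HasPt (uT k)) → (∀ k → All (a ≤_) (tags (uT k))) →
              (flatten ∘ uT) ≼ (λ j → d (a + j))
  flatten-≼ {uT} a basic pts a≤tags = below cut cut-< blocks
    where
    valid : ∀ k → T.Valid 0 (uT k)
    valid = TW.Basic′-single basic

    separated : ∀ k → All (_< firstTag (uT (suc k))) (tags (uT k))
    separated k = All-firstTag (pts (suc k)) (tags-separated (uT k) (TW.Basic′-pair basic ≤-refl))

    a≤first : ∀ k → a ≤ firstTag (uT k)
    a≤first k = All-firstTag (pts k) (a≤tags k)

    cut : ℕ → ℕ
    cut k = firstTag (uT k) ∸ a

    cut-< : ∀ k → cut k < cut (suc k)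
    cut-< k = ∸-monoˡ-< (All-firstTag (pts k) (separated k)) (a≤first k)

    blocks : ∀ k → Spans (λ j → d (a + j)) (cut k) (cut (suc k)) (flatten (uT k))
    blocks k = Spans-unshift a (a≤first k)
      (Spans-flatten (valid k) (pts k) (Ascending-firstTag (Valid⇒Ascending-tags (valid k))) (separated k))

module Enumeration (M : Monoid 0ℓ 0ℓ) (finite : IsFiniteMonoid M) (F : UniformPointedFamily M) where
  open Monoid M using (_≈_) renaming (Carrier to Mon)
  open Family M F
  open Words M F

  size : ℕ
  size = proj₁ finite

  element : Fin size → Mon
  element = proj₁ (proj₂ finite)

  index : Mon → Fin size
  index m = proj₁ (proj₂ (proj₂ finite) m)

  element-index : ∀ m → element (index m) ≈ m
  element-index m = proj₂ (proj₂ (proj₂ finite) m)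

  words : ℕ → ℕ → List Word
  words i zero    = [ [] ]
  words i (suc n) = words (suc i) n ++ concatMap (λ a → map ((element a , i) ∷_) (words (suc i) n)) (allFin size)

  normalise : Word → Word
  normalise = map (λ p → element (index (proj₁ p)) , proj₂ p)

  indices-normalise : ∀ ws → indices (normalise ws) ≡ indices ws
  indices-normalise ws = sym (map-∘ ws)

  eval-normalise : ∀ s ws → eval s (normalise ws) ≡ eval s ws
  eval-normalise s []             = refl
  eval-normalise s ((m , i) ∷ ws) = cong₂ _++_ (actS-≈ (element-index m) (s i)) (eval-normalise s ws)

  shift-bound : ∀ i n {is} → All (_< i + suc n) is → All (_< suc i + n) is
  shift-bound i n {is} = subst (λ b → All (_< b) is) (+-suc i n)

  normalise-∈-words : ∀ i n ws → Ascending i (indices ws) → All (_< i + n) (indices ws) → normalise ws ∈ words i n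
  normalise-∈-words i zero    []             _           _           = here refl
  normalise-∈-words i zero    (_ ∷ _)        (i≤j ∷ _)   (j<i+0 ∷ _)
    with () ← ≤⇒≯ i≤j (subst (_ <_) (+-identityʳ i) j<i+0)
  normalise-∈-words i (suc n) []             _           _           = ∈-++⁺ˡ (normalise-∈-words (suc i) n [] [] [])
  normalise-∈-words i (suc n) ((m , j) ∷ ws) (i≤j ∷ asc) bnd with m≤n⇒m<n∨m≡n i≤j
  ... | inj₁ i<j  = ∈-++⁺ˡ (normalise-∈-words (suc i) n ((m , j) ∷ ws) (i<j ∷ asc) (shift-bound i n bnd))
  ... | inj₂ refl =
    ∈-++⁺ʳ (words (suc i) n)
      (∈-concat⁺′ (∈-map⁺ ((element (index m) , i) ∷_)
                    (normalise-∈-words (suc i) n ws asc (shift-bound i n (All.tail bnd))))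
                  (∈-map⁺ (λ a → map ((element a , i) ∷_) (words (suc i) n)) (∈-allFin (index m))))

module Homogeneity (M : Monoid 0ℓ 0ℓ) (F : UniformPointedFamily M) where
  open Family M F
  open Words M F
  open PointedBasic using (seq)

  Subsequence : ∀ {n} → Vec (List U) n → (ℕ → List U) → Set
  Subsequence w t = Σ (List ℕ) λ js → Ascending 0 js × toList w ≡ map t js

  Subsequence-prefixVec : ∀ t n → Subsequence (prefixVec t n) t
  Subsequence-prefixVec t n = upTo n , Ascending-upTo n , toList-prefixVec t n

  Subsequence-drop : ∀ {n} {w : Vec (List U) n} {t} p {js} → Ascending p js → toList w ≡ map t js →
                     Subsequence w (λ i → t (p + i))
  Subsequence-drop {t = t} p {js} asc w≡ =
    map (_∸ p) js ,
    subst (λ b → Ascending b (map (_∸ p) js)) (n∸n≡0 p) (Ascending-map-∸ p ≤-refl asc) ,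
    trans w≡ (trans (map-cong-All (All.map (λ p≤j → cong t (sym (m+[n∸m]≡n p≤j))) (Ascending⇒All≥ asc))) (map-∘ js))

  Homogeneous : ∀ {n r} → (Vec (List U) n → Fin r) → (ℕ → List U) → Fin r → Set
  Homogeneous c s κ = ∀ t → t ≼ s → ∀ w → Subsequence w t → c w ≡ κ

  Homogeneous-≼ : ∀ {n r} {c : Vec (List U) n → Fin r} {s s′ κ} → s′ ≼ s → Homogeneous c s κ → Homogeneous c s′ κ
  Homogeneous-≼ s′≼s hom t t≼s′ = hom t (≼-trans t≼s′ s′≼s)

  OrderedRamsey : ℕ → Set
  OrderedRamsey n = ∀ (B : PointedBasic) r (c : Vec (List U) n → Fin r) →
    Σ PointedBasic λ S → seq S ≼ seq B × ∃ (Homogeneous c (seq S))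

  orderedRamsey-0 : OrderedRamsey 0
  orderedRamsey-0 B r c = B , ≼-refl (seq B) , c []ᵥ , λ { t t≼B []ᵥ _ → refl }

  -- The fusion sequence of the induction step: d k is the first entry of the k-th reservoir,
  -- and the (k+1)-st reservoir makes c (x ∷ _) homogeneous for every x spanned by d 0, …, d k.
  module Fusion (finite : IsFiniteMonoid M) {n} (IH : OrderedRamsey n) (B₀ : PointedBasic)
                {r} (c : Vec (List U) (suc n) → Fin r) where
    open Enumeration M finite F

    HomogeneousAfter : List U → (ℕ → List U) → Set
    HomogeneousAfter x s = ∃ (Homogeneous (λ w → c (x ∷ᵥ w)) s)

    refine : ∀ xs B → Σ PointedBasic λ B′ → seq B′ ≼ seq B × All (λ x → HomogeneousAfter x (seq B′)) xs
    refine []       B = B , ≼-refl (seq B) , []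
    refine (x ∷ xs) B =
      let (B₁ , B₁≼B , κ , hom) = IH B r (λ w → c (x ∷ᵥ w))
          (B₂ , B₂≼B₁ , homs)   = refine xs B₁
      in B₂ , ≼-trans B₂≼B₁ B₁≼B , (κ , Homogeneous-≼ B₂≼B₁ hom) ∷ homs

    record Stage : Set where
      constructor stage
      field
        reservoir : PointedBasic
        heads     : ℕ → List U
    open Stage

    -- heads agrees with d below the stage number.
    stages : ℕ → Stage
    stages zero    = stage B₀ (λ _ → [])
    stages (suc k) =
      let S  = stages k
          hs = update (heads S) k (seq (reservoir S) 0)
      in stage (proj₁ (refine (map (eval hs) (words 0 (suc k))) (tail (reservoir S)))) hs

    B : ℕ → PointedBasic
    B k = reservoir (stages k)

    d : ℕ → List U
    d k = seq (B k) 0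

    heads-agree : ∀ k {j} → j < k → heads (stages k) j ≡ d j
    heads-agree (suc k) {j} (s≤s j≤k) with m≤n⇒m<n∨m≡n j≤k
    ... | inj₁ j<k  = trans (update-≢ (heads (stages k)) (d k) (<⇒≢ j<k)) (heads-agree k j<k)
    ... | inj₂ refl = update-≡ (heads (stages j)) j (d j)

    refined : ∀ k → let xs = map (eval (heads (stages (suc k)))) (words 0 (suc k)) in
              Σ PointedBasic λ B′ → seq B′ ≼ seq (tail (B k)) × All (λ x → HomogeneousAfter x (seq B′)) xs
    refined k = refine (map (eval (heads (stages (suc k)))) (words 0 (suc k))) (tail (B k))

    B-≼-tail : ∀ k → seq (B (suc k)) ≼ (λ j → seq (B k) (suc j))
    B-≼-tail k = proj₁ (proj₂ (refined k))

    -- Every word over d 0, …, d k equals, up to normalisation, one of the finitely many words refined against.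
    homogeneousAfter-eval : ∀ k ws → Ascending 0 (indices ws) → All (_< suc k) (indices ws) →
                            HomogeneousAfter (eval d ws) (seq (B (suc k)))
    homogeneousAfter-eval k ws asc bnd =
      subst (λ x → HomogeneousAfter x (seq (B (suc k)))) eval≡
        (All.lookup (proj₂ (proj₂ (refined k)))
          (∈-map⁺ (eval (heads (stages (suc k)))) (normalise-∈-words 0 (suc k) ws asc bnd)))
      where
      eval≡ : eval (heads (stages (suc k))) (normalise ws) ≡ eval d ws
      eval≡ = trans (eval-cong (normalise ws) (All.map (heads-agree (suc k)) (subst (All _) (sym (indices-normalise ws)) bnd)))
                    (eval-normalise d ws)

    -- d (k + 1 + j) lies in B (k + 1) ≼ tail (B k), so its block in B k is the image of its block
    -- in B (k + 1) under the cut of B-≼-tail k, shifted by one.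
    diagonal-cut : ℕ → ℕ → ℕ
    diagonal-cut k zero    = 0
    diagonal-cut k (suc j) = suc (_≼_.cut (B-≼-tail k) (diagonal-cut (suc k) j))

    diagonal-cut-< : ∀ k j → diagonal-cut k j < diagonal-cut k (suc j)
    diagonal-cut-< k zero    = s≤s z≤n
    diagonal-cut-< k (suc j) = s≤s (σ-mono-< (diagonal-cut-< (suc k) j))
      where open StrictlyMonotone (_≼_.cut (B-≼-tail k)) (_≼_.cut-< (B-≼-tail k))

    diagonal-block : ∀ k j → Spans (seq (B k)) (diagonal-cut k j) (diagonal-cut k (suc j)) (d (k + j))
    diagonal-block k zero    =
      subst (Spans _ _ _) (cong d (sym (+-identityʳ k))) (Spans-widen (s≤s z≤n) (Spans-single (seq (B k)) 0))
    diagonal-block k (suc j) =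
      subst (Spans _ _ _) (cong d (sym (+-suc k j))) (Spans-shift 1 (Spans-≼ (B-≼-tail k) (diagonal-block (suc k) j)))

    diagonal-≼ : ∀ k → (λ j → d (k + j)) ≼ seq (B k)
    diagonal-≼ k = below (diagonal-cut k) (diagonal-cut-< k) (diagonal-block k)

    diagonal : PointedBasic
    diagonal = pointedBasic d (Basic-≼ (diagonal-≼ 0) (PointedBasic.basic B₀)) (λ k → PointedBasic.pointed (B k) 0)

  Homogeneous-prefixVec : ∀ {n r} {c : Vec (List U) n → Fin r} {s κ} → Homogeneous c s κ → c (prefixVec s n) ≡ κ
  Homogeneous-prefixVec {n} {s = s} hom = hom s (≼-refl s) (prefixVec s n) (Subsequence-prefixVec s n)

  homogeneous-unordered : ∀ {n r} {c : Vec (List U) n → Fin r} {s κ} → (∀ v w → toList v ↭ toList w → c v ≡ c w) →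
    Homogeneous c s κ → ∀ t → t ≼ s → ∀ v → Unique (toList v) → All (λ y → ∃ λ i → y ≡ t i) (toList v) → c v ≡ κ
  homogeneous-unordered c-symmetric hom t t≼s v unique v⊆t =
    let (is , v≡)      = indicesOf t v⊆t
        (w , v↭w , w≡) = sortAlong t v is v≡
    in trans (c-symmetric v w v↭w) (hom t t≼s w (sort is , sort-ascending (Unique.map⁻ (subst Unique v≡ unique)) , w≡))

  module Step (finite : IsFiniteMonoid M) (ramsey : IsRamsey M) {n} (IH : OrderedRamsey n) (B₀ : PointedBasic)
              {r} (c : Vec (List U) (suc n) → Fin r) where
    open Fusion finite IH B₀ c
    open Tagged M F d
    open PointedBasic

    beyond : List T.U → ℕ
    beyond xT = suc (max 0 (tags xT))

    colouring : List T.U → Fin r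
    colouring xT = c (flatten xT ∷ᵥ prefixVec (λ i → d (beyond xT + i)) n)

    homogeneous-beyond : ∀ {xT} → T.Valid 0 xT →
                         Homogeneous (λ w → c (flatten xT ∷ᵥ w)) (λ j → d (beyond xT + j)) (colouring xT)
    homogeneous-beyond {xT} val =
      let (ws , ix≡ , flat≡) = decode val
          (κ , hom) = subst (λ x → HomogeneousAfter x (seq (B (beyond xT)))) (sym flat≡)
                        (homogeneousAfter-eval (max 0 (tags xT)) ws
                          (subst (Ascending 0) (sym ix≡) (Valid⇒Ascending-tags val))
                          (subst (All _) (sym ix≡) (All.map s≤s (xs≤max 0 (tags xT)))))
          hom-d = Homogeneous-≼ (diagonal-≼ (beyond xT)) hom
      in subst (Homogeneous _ _) (sym (Homogeneous-prefixVec hom-d)) hom-d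

    coloured : ∃ λ sT → T.Basic sT × (∀ k → T.HasPt (sT k)) × ∃ λ κ → ∀ y → T.Span sT y → colouring y ≡ κ
    coloured = ramsey tagged r colouring

    sT : ℕ → List T.U
    sT = proj₁ coloured

    sT-basic : TW.Basic′ sT
    sT-basic = TW.Basic⇒Basic′ (proj₁ (proj₂ coloured))

    sT-pointed : ∀ k → T.HasPt (sT k)
    sT-pointed = proj₁ (proj₂ (proj₂ coloured))

    κ : Fin r
    κ = proj₁ (proj₂ (proj₂ (proj₂ coloured)))

    sT-monochromatic : ∀ y → T.Span sT y → colouring y ≡ κ
    sT-monochromatic = proj₂ (proj₂ (proj₂ (proj₂ coloured)))

    valid-below : ∀ {tT} → tT TW.≼ sT → ∀ k → T.Valid 0 (tT k)
    valid-below tT≼sT = TW.Basic′-single (TW.Basic-≼ tT≼sT sT-basic)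

    pointed-below : ∀ {tT} → tT TW.≼ sT → ∀ k → T.HasPt (tT k)
    pointed-below tT≼sT k = TW.HasPt-Spans sT-pointed (TW._≼_.block tT≼sT k)

    later-≼-beyond : ∀ {tT} → tT TW.≼ sT → ∀ j → (λ i → flatten (tT (suc j + i))) ≼ (λ i → d (beyond (tT j) + i))
    later-≼-beyond {tT} tT≼sT j =
      flatten-≼ (beyond (tT j)) (TW.Basic′-shift (suc j) tT-basic) (λ i → pointed-below tT≼sT (suc j + i)) beyond≤
      where
      tT-basic : TW.Basic′ tT
      tT-basic = TW.Basic-≼ tT≼sT sT-basic
      beyond≤ : ∀ i → All (beyond (tT j) ≤_) (tags (tT (suc j + i)))
      beyond≤ i = All.map (λ tags<y → max<v⁺ (≤-<-trans z≤n (All-firstTag (pointed-below tT≼sT j) tags<y)) tags<y)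
                    (tags-separated (tT j) (TW.Basic′-pair tT-basic (s≤s (m≤m+n j i))))

    open ≡-Reasoning

    -- The colour of (t j , t j₁ , …) is decided by t j alone, as t j₁ , … lie beyond every index used by t j.
    homogeneous : Homogeneous c (flatten ∘ sT) κ
    homogeneous t t≼s (x ∷ᵥ w′) (j ∷ js , (_ ∷ asc) , x∷w′≡) =
      let (tT , tT≼sT , flat≡) = ≼-flatten⁻ t≼s
          (x≡ , w′≡)           = ∷-injective x∷w′≡
      in begin
        c (x ∷ᵥ w′)               ≡⟨ cong (λ y → c (y ∷ᵥ w′)) (trans x≡ (sym (flat≡ j))) ⟩
        c (flatten (tT j) ∷ᵥ w′)  ≡⟨ homogeneous-beyond (valid-below tT≼sT j) _
                                       (≼-respˡ (λ i → flat≡ (suc j + i)) (later-≼-beyond tT≼sT j))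
                                       w′ (Subsequence-drop (suc j) asc w′≡) ⟩
        colouring (tT j)          ≡⟨ sT-monochromatic (tT j) (TW.Spans⇒Span (TW._≼_.block tT≼sT j)) ⟩
        κ                         ∎

    refinement : Σ PointedBasic λ S → seq S ≼ seq B₀ × ∃ (Homogeneous c (seq S))
    refinement =
      let s≼d = flatten-≼ 0 sT-basic sT-pointed (λ _ → All.universal (λ _ → z≤n) _)
      in pointedBasic (flatten ∘ sT) (Basic-≼ s≼d (basic diagonal))
                      (λ k → HasPt-Spans (pointed diagonal) (_≼_.block s≼d k)) ,
         ≼-trans s≼d (diagonal-≼ 0) , κ , homogeneous

  orderedRamsey : IsFiniteMonoid M → IsRamsey M → ∀ n → OrderedRamsey n
  orderedRamsey finite ramsey zero            = orderedRamsey-0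
  orderedRamsey finite ramsey (suc n) B₀ r c = Step.refinement finite ramsey (orderedRamsey finite ramsey n) B₀ c

theorem6p3 : (M : Monoid 0ℓ 0ℓ) → IsFiniteMonoid M → IsRamsey M →
  (n : ℕ) → 1 ≤ n → (F : UniformPointedFamily M) → (r : ℕ) →
  (c : Vec (List (UniformPointedFamily.U F)) n → Fin r) →
  (∀ v w → toList v ↭ toList w → c v ≡ c w) →
  let open Family M F in
  ∃ λ (s : ℕ → List U) → Basic s × (∀ k → HasPt (s k)) ×
    ∃ λ (κ : Fin r) → ∀ (t : ℕ → List U) → t ≤M s →
      ∀ (v : Vec (List U) n) → Unique (toList v) →
      All (λ y → ∃ λ i → y ≡ t i) (toList v) → c v ≡ κ
theorem6p3 M finite ramsey n _ F r c c-symmetric =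
  let open Words M F
      open Homogeneity M F
      open PointedBasic
      (S , _ , κ , hom) = orderedRamsey finite ramsey n points r c
  in seq S , Basic′⇒Basic (basic S) , pointed S , κ ,
     λ t t≤s → homogeneous-unordered c-symmetric hom t (≤M⇒≼ t≤s)
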